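{- For each integer $k \geq 3$ there exists an $\varepsilon > 0$ such that for all integers $n$ and $c$, and for each orientation $C$ of a $k$-cycle consisting of exactly two blocks, one of which has length one, there exists a digraph $D$ with $|V(D)| \geq n$, $\chi(D) \geq c$, and minimum out-degree at least $\varepsilon |V(D)|$, such that $D$ does not contain a subdigraph isomorphic to $C$.
   Context: Digraphs have no loops and no parallel arcs (anti-parallel arcs allowed); $\chi(D)$ is the chromatic number of the underlying undirected graph; subdigraphs need not be induced. A block of an orientation of a cycle is a maximal connected subdigraph containing neither $x\rightarrow y\leftarrow z$ nor $x\leftarrow y\rightarrow z$ as a subdigraph; its length is its number of arcs. -}

module Defs where

open import Data.Nat using (ℕ; zero; suc; _+_; _∸_; _≤_; _<_; NonZero)
open import Data.Nat.DivMod using (_mod_)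
open import Data.Fin using (Fin; toℕ) renaming (zero to fzero; suc to fsuc)
open import Data.Bool using (Bool; true; false; if_then_else_)
open import Data.Product using (Σ; _×_; _,_)
open import Data.Sum using (_⊎_)
open import Data.Integer using (+_)
open import Data.Rational using (ℚ; _/_; _*_) renaming (_≤_ to _≤ℚ_)
open import Function.Definitions using (Injective)
open import Relation.Binary.PropositionalEquality using (_≡_; _≢_)

-- Finite digraphs: vertex set Fin N, arc relation given as a Boolean
-- matrix (so no parallel arcs; anti-parallel arcs allowed), loopless.

record Digraph : Set where
  field
    N        : ℕ
    arc      : Fin N → Fin N → Bool
    loopless : ∀ v → arc v v ≡ false
open Digraph public

countTrue : (n : ℕ) → (Fin n → Bool) → ℕ
countTrue zero    p = 0
countTrue (suc n) p = (if p fzero then 1 else 0) + countTrue n (λ w → p (fsuc w))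

outdeg : (D : Digraph) → Fin (N D) → ℕ
outdeg D v = countTrue (N D) (arc D v)

MinOutdegAtLeast : ℚ → Digraph → Set
MinOutdegAtLeast ε D = ∀ v → ε * ((+ N D) / 1) ≤ℚ ((+ outdeg D v) / 1)

ProperColouring : (D : Digraph) (m : ℕ) → (Fin (N D) → Fin m) → Set
ProperColouring D m col = ∀ u v → arc D u v ≡ true → col u ≢ col v

ChromaticAtLeast : Digraph → ℕ → Set
ChromaticAtLeast D c = ∀ m (col : Fin (N D) → Fin m) → ProperColouring D m col → c ≤ m

-- Orientations of the k-cycle on vertices Fin k with edges
-- e_i = {i, i+1 mod k}.  o i ≡ true means the arc i → i+1, false means i+1 → i.

Orientation : ℕ → Set
Orientation k = Fin k → Bool

module _ (k : ℕ) .{{_ : NonZero k}} where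

  dirAt : Orientation k → ℕ → Bool
  dirAt o j = o (j mod k)

  CArc : Orientation k → Fin k → Fin k → Set
  CArc o a b = Σ (Fin k) λ i →
      (o i ≡ true  × a ≡ i × b ≡ (suc (toℕ i)) mod k)
    ⊎ (o i ≡ false × a ≡ (suc (toℕ i)) mod k × b ≡ i)

  -- A block: the edges s, s+1, …, s+ℓ-1 (cyclically), 1 ≤ ℓ ≤ k, all
  -- oriented the same way (i.e. forming a directed path, containing no
  -- x→y←z or x←y→z), and maximal: if ℓ < k the neighbouring edges
  -- s-1 and s+ℓ are oriented the other way.
  Block : Orientation k → Fin k → ℕ → Set
  Block o s ℓ =
      1 ≤ ℓ × ℓ ≤ k
    × (∀ t → t < ℓ → dirAt o (toℕ s + t) ≡ o s)
    × (ℓ < k → dirAt o (toℕ s + ℓ) ≢ o s)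
    × (ℓ < k → dirAt o (toℕ s + (k ∸ 1)) ≢ o s)

  TwoBlocksOneOfLengthOne : Orientation k → Set
  TwoBlocksOneOfLengthOne o =
    Σ (Fin k) λ s₁ → Σ (Fin k) λ s₂ → Σ ℕ λ ℓ₂ →
        s₁ ≢ s₂ × Block o s₁ 1 × Block o s₂ ℓ₂
      × (∀ s ℓ → Block o s ℓ → s ≡ s₁ ⊎ s ≡ s₂)

  ContainsOrientedCycle : Digraph → Orientation k → Set
  ContainsOrientedCycle D o =
    Σ (Fin k → Fin (N D)) λ f → Injective _≡_ _≡_ f
      × (∀ a b → CArc o a b → arc D (f a) (f b) ≡ true)

-- Write ℓ = k − 1. An orientation of the k-cycle with two blocks, one of
-- length one, is a directed path x₀ → x₁ → ⋯ → x_ℓ together with the arc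
-- x₀ → x_ℓ, so it suffices that D admits no such shortcut walk, not even a
-- non-injective one. D has three parts: the shift graph on ℓ-tuples over
-- [n], whose chromatic number exceeds c once n exceeds a tower of height
-- ℓ − 1 over c; all subsets X of [n], with an arc u → X whenever
-- head u ∉ X ∋ last u; and a blow-up of a directed k-cycle of layers, entered
-- from the subsets and from the tuples with head u = last u. No arc leads
-- back to an earlier part. Along a walk through the tuples the last entry of
-- the first tuple moves one place to the left per step, so after ℓ − 1 steps
-- it is the head; this rules out a shortcut into the tuples (heads increase
-- along shift arcs) as well as one into the subsets. On the k-cycle of
-- layers, ℓ steps never end where one step does, nor ℓ − 1 steps where they
-- started. Taking many copies of every subset and every layer makes each
-- out-degree at least |V(D)| / 4(k + 2).

module Submission where

open import Defs
open import Data.Bool as Bool using (Bool; true; false; not; _∧_; if_then_else_)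
open import Data.Bool.Properties using (∧-comm; ∧-identityʳ; ∧-conicalˡ; ∧-conicalʳ; ¬-not)
open import Data.Fin as Fin using (Fin; zero; suc; toℕ; _↑ˡ_; _↑ʳ_; splitAt; remQuot; quotient; remainder; finToFun; funToFin)
open import Data.Fin.Properties as Fin using (splitAt-↑ˡ; splitAt-↑ʳ)
open import Data.Fin.Patterns using (0F; 1F)
open import Data.Nat as ℕ using (ℕ; zero; suc; _+_; _*_; _^_; _∸_; _≤_; _<_; z≤n; s≤s; _%_; NonZero)
open import Data.Nat.Properties
open import Data.Nat.DivMod using (_mod_; m%n<n; m<n⇒m%n≡m; [m+n]%n≡m%n; %-distribˡ-+; m%n%n≡m%n; m≡m%n+[m/n]*n)
open import Data.Nat.Divisibility using (divides; >⇒∤)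
open import Data.Product using (Σ; ∃-syntax; _×_; _,_; proj₁; proj₂; uncurry; map₁)
open import Data.Sum using (_⊎_; inj₁; inj₂; [_,_]′)
open import Function using (_∘_)
open import Data.Empty using (⊥)
open import Relation.Nullary using (¬_; Dec; yes; no; does; contradiction; _×-dec_)
open import Relation.Nullary.Decidable using (dec-true; dec-false; map′)
open import Data.Vec.Functional using (Vector; _∷_; head; tail; init; last)
open import Function.Bundles using (Inverse)
open import Relation.Unary using (Decidable)
open import Relation.Binary.PropositionalEquality
open import Data.Integer as ℤ using (+≤+)
import Data.Integer.Properties as ℤ
open import Data.Rational using (ℚ; 0ℚ; _/_; toℚᵘ) renaming (_*_ to _*ℚ_; _≤_ to _≤ℚ_; _<_ to _<ℚ_)
import Data.Rational.Properties as ℚ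
open import Data.Rational.Unnormalised as ℚᵘ using (mkℚᵘ; *≤*)
import Data.Rational.Unnormalised.Properties as ℚᵘ

dec-true⁻¹ : ∀ {P : Set} (P? : Dec P) → does P? ≡ true → P
dec-true⁻¹ (yes p) _ = p

inject₁-lower₁ : ∀ {m} (i : Fin (suc m)) (m≢i : m ≢ toℕ i) → Fin.inject₁ (Fin.lower₁ i m≢i) ≡ i
inject₁-lower₁ i m≢i = Fin.toℕ-injective (trans (Fin.toℕ-inject₁ _) (Fin.toℕ-lower₁ i m≢i))

countTrue-cong : ∀ n {p q : Fin n → Bool} → p ≗ q → countTrue n p ≡ countTrue n q
countTrue-cong zero    p≗q = refl
countTrue-cong (suc n) p≗q =
  cong₂ _+_ (cong (λ b → if b then 1 else 0) (p≗q zero)) (countTrue-cong n (p≗q ∘ suc))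

countTrue-mono : ∀ n {p q : Fin n → Bool} → (∀ w → p w ≡ true → q w ≡ true) →
                 countTrue n p ≤ countTrue n q
countTrue-mono zero    p⇒q = z≤n
countTrue-mono (suc n) {p} {q} p⇒q =
  +-mono-≤ (head≤ (p zero) (q zero) (p⇒q zero)) (countTrue-mono n (p⇒q ∘ suc))
  where
  head≤ : ∀ x y → (x ≡ true → y ≡ true) → (if x then 1 else 0) ≤ (if y then 1 else 0)
  head≤ false y _   = z≤n
  head≤ true  y x⇒y rewrite x⇒y refl = ≤-refl

countTrue-false : ∀ n → countTrue n (λ _ → false) ≡ 0
countTrue-false zero    = refl
countTrue-false (suc n) = countTrue-false n

countTrue-true : ∀ n → countTrue n (λ _ → true) ≡ n
countTrue-true zero    = refl
countTrue-true (suc n) = cong suc (countTrue-true n)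

countTrue-+ : ∀ m n (p : Fin (m + n) → Bool) →
              countTrue (m + n) p ≡ countTrue m (p ∘ (_↑ˡ n)) + countTrue n (p ∘ (m ↑ʳ_))
countTrue-+ zero    n p = refl
countTrue-+ (suc m) n p =
  trans (cong ((if p zero then 1 else 0) +_) (countTrue-+ m n (p ∘ suc)))
        (sym (+-assoc (if p zero then 1 else 0) (countTrue m (p ∘ suc ∘ (_↑ˡ n))) _))

countTrue-↑ˡ-≤ : ∀ m n (p : Fin (m + n) → Bool) → countTrue m (p ∘ (_↑ˡ n)) ≤ countTrue (m + n) p
countTrue-↑ˡ-≤ m n p = ≤-trans (m≤m+n _ _) (≤-reflexive (sym (countTrue-+ m n p)))

countTrue-↑ʳ-≤ : ∀ m n (p : Fin (m + n) → Bool) → countTrue n (p ∘ (m ↑ʳ_)) ≤ countTrue (m + n) p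
countTrue-↑ʳ-≤ m n p = ≤-trans (m≤n+m _ _) (≤-reflexive (sym (countTrue-+ m n p)))

remQuot-↑ˡ : ∀ {m} n (r : Fin n) → remQuot {suc m} n (r ↑ˡ (m * n)) ≡ (zero , r)
remQuot-↑ˡ {m} n r rewrite splitAt-↑ˡ n r (m * n) = refl

remQuot-↑ʳ : ∀ {m} n (w : Fin (m * n)) → remQuot {suc m} n (n ↑ʳ w) ≡ map₁ suc (remQuot {m} n w)
remQuot-↑ʳ {m} n w rewrite splitAt-↑ʳ n (m * n) w = refl

countTrue-remQuot : ∀ m n (p : Fin (suc m) → Fin n → Bool) →
  countTrue (suc m * n) (uncurry p ∘ remQuot n) ≡
  countTrue n (p zero) + countTrue (m * n) (uncurry (p ∘ suc) ∘ remQuot n)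
countTrue-remQuot m n p = trans (countTrue-+ n (m * n) _) (cong₂ _+_
  (countTrue-cong n (cong (uncurry p) ∘ remQuot-↑ˡ n))
  (countTrue-cong (m * n) (cong (uncurry p) ∘ remQuot-↑ʳ n)))

countTrue-remainder : ∀ m n (p : Fin n → Bool) → countTrue (m * n) (p ∘ remainder {m} n) ≡ m * countTrue n p
countTrue-remainder zero    n p = refl
countTrue-remainder (suc m) n p =
  trans (countTrue-remQuot m n (λ _ → p)) (cong (countTrue n p +_) (countTrue-remainder m n p))

countTrue-quotient : ∀ m n (i : Fin m) (p : Fin n → Bool) →
  countTrue (m * n) (λ w → does (quotient n w Fin.≟ i) ∧ p (remainder {m} n w)) ≡ countTrue n p
countTrue-quotient (suc m) n zero p = begin
  countTrue (suc m * n) (λ w → does (quotient n w Fin.≟ zero) ∧ p (remainder n w))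
    ≡⟨ countTrue-remQuot m n (λ j r → does (j Fin.≟ zero) ∧ p r) ⟩
  countTrue n p + countTrue (m * n) (λ _ → false) ≡⟨ cong (countTrue n p +_) (countTrue-false (m * n)) ⟩
  countTrue n p + 0                                 ≡⟨ +-identityʳ _ ⟩
  countTrue n p                                     ∎
  where open ≡-Reasoning
countTrue-quotient (suc m) n (suc i) p = begin
  countTrue (suc m * n) (λ w → does (quotient n w Fin.≟ suc i) ∧ p (remainder n w))
    ≡⟨ countTrue-remQuot m n (λ j r → does (j Fin.≟ suc i) ∧ p r) ⟩
  countTrue n (λ _ → false)
    + countTrue (m * n) (λ w → does (quotient {m} n w Fin.≟ i) ∧ p (remainder {m} n w))
    ≡⟨ cong₂ _+_ (countTrue-false n) (countTrue-quotient m n i p) ⟩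
  countTrue n p ∎
  where open ≡-Reasoning

countTrue-finToFun-≡ : ∀ m q (a : Fin q) (x : Fin m) →
  m * countTrue (m ^ q) (λ w → does (finToFun w a Fin.≟ x)) ≡ m ^ q
countTrue-finToFun-≡ m (suc q) zero x = cong (m *_) (begin
  countTrue (m * m ^ q) (λ w → does (quotient (m ^ q) w Fin.≟ x))
    ≡⟨ countTrue-cong (m * m ^ q) (λ w → sym (∧-identityʳ _)) ⟩
  countTrue (m * m ^ q) (λ w → does (quotient (m ^ q) w Fin.≟ x) ∧ true)
    ≡⟨ countTrue-quotient m (m ^ q) x (λ _ → true) ⟩
  countTrue (m ^ q) (λ _ → true)
    ≡⟨ countTrue-true (m ^ q) ⟩
  m ^ q ∎)
  where open ≡-Reasoning
countTrue-finToFun-≡ m (suc q) (suc a) x =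
  cong (m *_) (trans (countTrue-remainder m (m ^ q) _) (countTrue-finToFun-≡ m q a x))

countTrue-finToFun-≡≡ : ∀ m q {a b : Fin q} → a ≢ b → (x y : Fin m) →
  m * m * countTrue (m ^ q) (λ w → does (finToFun w a Fin.≟ x) ∧ does (finToFun w b Fin.≟ y)) ≡ m ^ q
countTrue-finToFun-≡≡ m (suc q) {zero} {zero} a≢b x y = contradiction refl a≢b
countTrue-finToFun-≡≡ m (suc q) {zero} {suc b} a≢b x y = begin
  m * m * countTrue (m * m ^ q) (λ w → does (quotient (m ^ q) w Fin.≟ x) ∧ has-y (remainder {m} (m ^ q) w))
    ≡⟨ cong (m * m *_) (countTrue-quotient m (m ^ q) x has-y) ⟩
  m * m * countTrue (m ^ q) has-y
    ≡⟨ *-assoc m m _ ⟩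
  m * (m * countTrue (m ^ q) has-y)
    ≡⟨ cong (m *_) (countTrue-finToFun-≡ m q b y) ⟩
  m ^ suc q ∎
  where
  open ≡-Reasoning
  has-y : Fin (m ^ q) → Bool
  has-y w = does (finToFun w b Fin.≟ y)
countTrue-finToFun-≡≡ m (suc q) {suc a} {zero} a≢b x y = begin
  m * m * countTrue (m * m ^ q) (λ w → has-x (remainder {m} (m ^ q) w) ∧ does (quotient (m ^ q) w Fin.≟ y))
    ≡⟨ cong (m * m *_) (countTrue-cong (m * m ^ q) (λ w → ∧-comm (has-x (remainder {m} (m ^ q) w)) _)) ⟩
  m * m * countTrue (m * m ^ q) (λ w → does (quotient (m ^ q) w Fin.≟ y) ∧ has-x (remainder {m} (m ^ q) w))
    ≡⟨ cong (m * m *_) (countTrue-quotient m (m ^ q) y has-x) ⟩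
  m * m * countTrue (m ^ q) has-x
    ≡⟨ *-assoc m m _ ⟩
  m * (m * countTrue (m ^ q) has-x)
    ≡⟨ cong (m *_) (countTrue-finToFun-≡ m q a x) ⟩
  m ^ suc q ∎
  where
  open ≡-Reasoning
  has-x : Fin (m ^ q) → Bool
  has-x w = does (finToFun w a Fin.≟ x)
countTrue-finToFun-≡≡ m (suc q) {suc a} {suc b} a≢b x y = begin
  m * m * countTrue (m * m ^ q) (has-xy ∘ remainder {m} (m ^ q))
    ≡⟨ cong (m * m *_) (countTrue-remainder m (m ^ q) has-xy) ⟩
  m * m * (m * countTrue (m ^ q) has-xy)
    ≡⟨ *-assoc m m _ ⟩
  m * (m * (m * countTrue (m ^ q) has-xy))
    ≡⟨ cong (m *_) (*-assoc m m _) ⟨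
  m * (m * m * countTrue (m ^ q) has-xy)
    ≡⟨ cong (m *_) (countTrue-finToFun-≡≡ m q (a≢b ∘ cong suc) x y) ⟩
  m ^ suc q ∎
  where
  open ≡-Reasoning
  has-xy : Fin (m ^ q) → Bool
  has-xy w = does (finToFun w a Fin.≟ x) ∧ does (finToFun w b Fin.≟ y)

record ShortcutWalk {V : Set} (E : V → V → Set) (ℓ : ℕ) : Set where
  field
    vertex   : ℕ → V
    step     : ∀ i → i < ℓ → E (vertex i) (vertex (suc i))
    shortcut : E (vertex 0) (vertex ℓ)

ShortcutWalk-map : ∀ {V W : Set} {E : V → V → Set} {F : W → W → Set} {ℓ} (f : V → W) →
                   (∀ {x y} → E x y → F (f x) (f y)) → ShortcutWalk E ℓ → ShortcutWalk F ℓ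
ShortcutWalk-map f hom W = record
  { vertex = f ∘ vertex ; step = λ i i<ℓ → hom (step i i<ℓ) ; shortcut = hom shortcut }
  where open ShortcutWalk W

module _ {P : ℕ → Set} (P? : Decidable P) where

  prefix-or-failure : ∀ t → (∀ i → i < t → P i)
                          ⊎ ∃[ ℓ ] ℓ < t × (∀ i → i < ℓ → P i) × ¬ P ℓ
  prefix-or-failure zero = inj₁ (λ _ ())
  prefix-or-failure (suc t) with prefix-or-failure t
  ... | inj₂ (ℓ , ℓ<t , below , ¬Pℓ) = inj₂ (ℓ , m<n⇒m<1+n ℓ<t , below , ¬Pℓ)
  ... | inj₁ below with P? t
  ...   | yes Pt = inj₁ λ i i<1+t → [ below i , (λ { refl → Pt }) ]′ (m<1+n⇒m<n∨m≡n i<1+t)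
  ...   | no ¬Pt = inj₂ (t , n<1+n t , below , ¬Pt)

  least-failure : ∀ t → ¬ P t → ∃[ ℓ ] ℓ ≤ t × (∀ i → i < ℓ → P i) × ¬ P ℓ
  least-failure t ¬Pt with prefix-or-failure t
  ... | inj₁ below = t , ≤-refl , below , ¬Pt
  ... | inj₂ (ℓ , ℓ<t , rest) = ℓ , <⇒≤ ℓ<t , rest

  transition : ∀ {a} t → ¬ P a → P (a + t) → ∃[ j ] j < a + t × ¬ P j × P (suc j)
  transition {a} zero ¬Pa Pa+0 = contradiction (subst P (+-identityʳ a) Pa+0) ¬Pa
  transition {a} (suc t) ¬Pa Pa+1+t with P? (a + t)
  ... | yes Pa+t = let j , j<a+t , rest = transition t ¬Pa Pa+t in
                   j , <-trans j<a+t (+-monoʳ-< a (n<1+n t)) , rest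
  ... | no ¬Pa+t = a + t , +-monoʳ-< a (n<1+n t) , ¬Pa+t , subst P (+-suc a t) Pa+1+t

[m%n+o]%n≡[m+o]%n : ∀ m o n .{{_ : NonZero n}} → (m % n + o) % n ≡ (m + o) % n
[m%n+o]%n≡[m+o]%n m o n = begin
  (m % n + o) % n          ≡⟨ %-distribˡ-+ (m % n) o n ⟩
  (m % n % n + o % n) % n  ≡⟨ cong (λ x → (x + o % n) % n) (m%n%n≡m%n m n) ⟩
  (m % n + o % n) % n      ≡⟨ %-distribˡ-+ m o n ⟨
  (m + o) % n              ∎
  where open ≡-Reasoning

module Cyclic (k₀ : ℕ) where

  private
    k : ℕ
    k = suc k₀

  infixl 6 _⊕_

  -- chosen so that dirAt k o (toℕ s + t), as used in Block, is o (s ⊕ t)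
  _⊕_ : Fin k → ℕ → Fin k
  s ⊕ t = (toℕ s + t) mod k

  toℕ-⊕ : ∀ s t → toℕ (s ⊕ t) ≡ (toℕ s + t) % k
  toℕ-⊕ s t = Fin.toℕ-fromℕ< (m%n<n (toℕ s + t) k)

  ⊕-identityʳ : ∀ s → s ⊕ 0 ≡ s
  ⊕-identityʳ s = Fin.toℕ-injective (begin
    toℕ (s ⊕ 0)       ≡⟨ toℕ-⊕ s 0 ⟩
    (toℕ s + 0) % k   ≡⟨ cong (_% k) (+-identityʳ (toℕ s)) ⟩
    toℕ s % k         ≡⟨ m<n⇒m%n≡m (Fin.toℕ<n s) ⟩
    toℕ s             ∎)
    where open ≡-Reasoning

  ⊕-assoc : ∀ s a b → s ⊕ a ⊕ b ≡ s ⊕ (a + b)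
  ⊕-assoc s a b = Fin.toℕ-injective (begin
    toℕ (s ⊕ a ⊕ b)           ≡⟨ toℕ-⊕ (s ⊕ a) b ⟩
    (toℕ (s ⊕ a) + b) % k     ≡⟨ cong (λ x → (x + b) % k) (toℕ-⊕ s a) ⟩
    ((toℕ s + a) % k + b) % k ≡⟨ [m%n+o]%n≡[m+o]%n (toℕ s + a) b k ⟩
    (toℕ s + a + b) % k       ≡⟨ cong (_% k) (+-assoc (toℕ s) a b) ⟩
    (toℕ s + (a + b)) % k     ≡⟨ toℕ-⊕ s (a + b) ⟨
    toℕ (s ⊕ (a + b))         ∎)
    where open ≡-Reasoning

  ⊕-+k : ∀ s t → s ⊕ (t + k) ≡ s ⊕ t
  ⊕-+k s t = Fin.toℕ-injective (begin
    toℕ (s ⊕ (t + k))       ≡⟨ toℕ-⊕ s (t + k) ⟩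
    (toℕ s + (t + k)) % k   ≡⟨ cong (_% k) (+-assoc (toℕ s) t k) ⟨
    (toℕ s + t + k) % k     ≡⟨ [m+n]%n≡m%n (toℕ s + t) k ⟩
    (toℕ s + t) % k         ≡⟨ toℕ-⊕ s t ⟨
    toℕ (s ⊕ t)             ∎)
    where open ≡-Reasoning

  ⊕-k : ∀ s → s ⊕ k ≡ s
  ⊕-k s = trans (⊕-+k s 0) (⊕-identityʳ s)

  ⊕-one : ∀ s → s ⊕ 1 ≡ suc (toℕ s) mod k
  ⊕-one s = cong (_mod k) (+-comm (toℕ s) 1)

  ⊕-suc : ∀ s t → s ⊕ suc t ≡ suc (toℕ (s ⊕ t)) mod k
  ⊕-suc s t = begin
    s ⊕ suc t                 ≡⟨ cong (s ⊕_) (+-comm 1 t) ⟩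
    s ⊕ (t + 1)               ≡⟨ ⊕-assoc s t 1 ⟨
    s ⊕ t ⊕ 1                 ≡⟨ ⊕-one (s ⊕ t) ⟩
    suc (toℕ (s ⊕ t)) mod k   ∎
    where open ≡-Reasoning

  ⊕-suc-⊕-k₀ : ∀ s j → s ⊕ suc j ⊕ k₀ ≡ s ⊕ j
  ⊕-suc-⊕-k₀ s j = begin
    s ⊕ suc j ⊕ k₀     ≡⟨ ⊕-assoc s (suc j) k₀ ⟩
    s ⊕ (suc j + k₀)   ≡⟨ cong (s ⊕_) (+-suc j k₀) ⟨
    s ⊕ (j + k)        ≡⟨ ⊕-+k s j ⟩
    s ⊕ j              ∎
    where open ≡-Reasoning

  s⊕t≡s⇒t≡0 : ∀ {s t} → t < k → s ⊕ t ≡ s → t ≡ 0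
  s⊕t≡s⇒t≡0 {s} {zero}  _   _     = refl
  s⊕t≡s⇒t≡0 {s} {suc t} t<k s⊕t≡s = contradiction (divides q t≡[q]k) (>⇒∤ t<k)
    where
    q : ℕ
    q = (toℕ s + suc t) ℕ./ k
    t≡[q]k : suc t ≡ q * k
    t≡[q]k = +-cancelˡ-≡ (toℕ s) (suc t) (q * k) (begin
      toℕ s + suc t                  ≡⟨ m≡m%n+[m/n]*n (toℕ s + suc t) k ⟩
      (toℕ s + suc t) % k + q * k    ≡⟨ cong (_+ q * k) (trans (sym (toℕ-⊕ s (suc t))) (cong toℕ s⊕t≡s)) ⟩
      toℕ s + q * k                  ∎)
      where open ≡-Reasoning

  block-from : ∀ o s → o (s ⊕ k₀) ≢ o s → ∃[ ℓ ] Block k o s ℓ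
  block-from o s before≢ with least-failure (λ t → o (s ⊕ t) Bool.≟ o s) k₀ before≢
  ... | zero  , _ , _ , ¬same = contradiction (cong o (⊕-identityʳ s)) ¬same
  ... | suc ℓ , 1+ℓ≤k₀ , same , ¬same =
    suc ℓ , s≤s z≤n , m≤n⇒m≤1+n 1+ℓ≤k₀ , same , (λ _ → ¬same) , (λ _ → before≢)

  block-at-change : ∀ o s j → o (s ⊕ j) ≢ o (s ⊕ suc j) → ∃[ ℓ ] Block k o (s ⊕ suc j) ℓ
  block-at-change o s j change =
    block-from o (s ⊕ suc j) (subst (λ x → o x ≢ o (s ⊕ suc j)) (sym (⊕-suc-⊕-k₀ s j)) change)

  module _ (o : Orientation k) {s₁ s₂ : Fin k} (short : Block k o s₁ 1)
           (only : ∀ s ℓ → Block k o s ℓ → s ≡ s₁ ⊎ s ≡ s₂) where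

    -- A change of direction inside s₁ + 1, …, s₁ + k₀ would start a block
    -- there besides the one at s₁ + 1, but only s₂ is left for both.
    opposite-after-short-block : ∀ t → 1 ≤ t → t < k → o (s₁ ⊕ t) ≡ not (o s₁)
    opposite-after-short-block (suc t) _ 1+t<k = ¬-not λ same →
      let j , j<1+t , ¬same-j , same-1+j = transition (λ i → o (s₁ ⊕ i) Bool.≟ o s₁) t next≢ same
      in [ (λ s₁⊕1+j≡s₁ → contradiction (s⊕t≡s⇒t≡0 (≤-<-trans j<1+t 1+t<k) s₁⊕1+j≡s₁) λ ())
         , (λ s₁⊕1+j≡s₂ → next≢ (trans (cong o (trans s₁⊕1≡s₂ (sym s₁⊕1+j≡s₂))) same-1+j))
         ]′ (only _ _ (proj₂ (block-at-change o s₁ j (λ e → ¬same-j (trans e same-1+j)))))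
      where
      next≢ : o (s₁ ⊕ 1) ≢ o s₁
      next≢ = proj₁ (proj₂ (proj₂ (proj₂ short))) (≤-<-trans (s≤s z≤n) 1+t<k)
      s₁⊕1≡s₂ : s₁ ⊕ 1 ≡ s₂
      s₁⊕1≡s₂ = [ (λ s₁⊕1≡s₁ → contradiction (cong o s₁⊕1≡s₁) next≢) , (λ eq → eq) ]′
        (only _ _ (proj₂ (block-at-change o s₁ 0 λ e → next≢ (trans (sym e) (cong o (⊕-identityʳ s₁))))))

  -- All edges but s₁ point against it, so read from s₁ + 1 forwards or from
  -- s₁ backwards the cycle is a directed path closed up by the edge s₁.
  twoBlocks⇒shortcutWalk : ∀ o → TwoBlocksOneOfLengthOne k o → ShortcutWalk (CArc k o) k₀
  twoBlocks⇒shortcutWalk o (s₁ , s₂ , _ , _ , short , _ , only) = walk (o s₁) refl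
    where
    opposite : ∀ {b} → o s₁ ≡ b → ∀ t → 1 ≤ t → t < k → o (s₁ ⊕ t) ≡ not b
    opposite o[s₁] t 1≤t t<k = trans (opposite-after-short-block o short only t 1≤t t<k) (cong not o[s₁])

    walk : ∀ b → o s₁ ≡ b → ShortcutWalk (CArc k o) k₀
    walk false o[s₁] = record
      { vertex   = λ i → s₁ ⊕ suc i
      ; step     = λ i i<k₀ → s₁ ⊕ suc i ,
          inj₁ (opposite o[s₁] (suc i) (s≤s z≤n) (s≤s i<k₀) , refl , ⊕-suc s₁ (suc i))
      ; shortcut = s₁ , inj₂ (o[s₁] , ⊕-one s₁ , ⊕-k s₁)
      }
    walk true o[s₁] = record
      { vertex   = λ i → s₁ ⊕ (k ∸ i)
      ; step     = λ i i<k₀ → s₁ ⊕ (k₀ ∸ i) , inj₂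
          ( opposite o[s₁] (k₀ ∸ i) (m<n⇒0<n∸m i<k₀) (s≤s (m∸n≤m k₀ i))
          , trans (cong (s₁ ⊕_) (+-∸-assoc 1 (<⇒≤ i<k₀))) (⊕-suc s₁ (k₀ ∸ i))
          , refl )
      ; shortcut = s₁ , inj₁ (o[s₁] , ⊕-k s₁ , trans (cong (s₁ ⊕_) (m+n∸n≡m 1 k₀)) (⊕-one s₁))
      }

-- Shift graphs

Increasing : ∀ {m n} → Vector (Fin n) (suc m) → Set
Increasing w = ∀ i → init w i Fin.< tail w i

ShiftArc : ∀ {m n} → Vector (Fin n) (suc m) → Vector (Fin n) (suc m) → Set
ShiftArc u v = init v ≗ tail u × Increasing (head u ∷ v)

ShiftArc? : ∀ {m n} (u v : Vector (Fin n) (suc m)) → Dec (ShiftArc u v)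
ShiftArc? u v = Fin.all? (λ i → init v i Fin.≟ tail u i)
          ×-dec Fin.all? (λ i → init (head u ∷ v) i Fin.<? tail (head u ∷ v) i)

ShiftArc-resp-≗ : ∀ {m n} {u u' v v' : Vector (Fin n) (suc m)} →
                  u ≗ u' → v ≗ v' → ShiftArc u v → ShiftArc u' v'
ShiftArc-resp-≗ {u = u} {u'} {v} {v'} u≗u' v≗v' (shifted , increasing) =
  (λ i → trans (sym (v≗v' (Fin.inject₁ i))) (trans (shifted i) (u≗u' (suc i)))) ,
  (λ i → subst₂ Fin._<_ (cons≗ (Fin.inject₁ i)) (cons≗ (suc i)) (increasing i))
  where
  cons≗ : (head u ∷ v) ≗ (head u' ∷ v')
  cons≗ zero    = u≗u' zero
  cons≗ (suc i) = v≗v' i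

Increasing⇒head≤ : ∀ {m n} {w : Vector (Fin n) (suc m)} → Increasing w → ∀ j → head w Fin.≤ w j
Increasing⇒head≤ increasing zero = ≤-refl
Increasing⇒head≤ {suc m} increasing (suc j) =
  ≤-trans (Increasing⇒head≤ (increasing ∘ Fin.inject₁) j) (<⇒≤ (increasing j))

ShiftArc⇒head≤last : ∀ {m n} {u v : Vector (Fin n) (2 + m)} → ShiftArc u v → head v Fin.≤ last u
ShiftArc⇒head≤last {m} {u = u} {v} (shifted , increasing) =
  subst (head v Fin.≤_) (shifted (Fin.fromℕ m))
        (Increasing⇒head≤ {w = v} (increasing ∘ suc) (Fin.inject₁ (Fin.fromℕ m)))

tower : ℕ → ℕ → ℕ
tower zero    q = q
tower (suc m) q = tower m (2 ^ q)

tower-monoʳ-≤ : ∀ m {a b} → a ≤ b → tower m a ≤ tower m b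
tower-monoʳ-≤ zero    a≤b = a≤b
tower-monoʳ-≤ (suc m) a≤b = tower-monoʳ-≤ m (^-monoʳ-≤ 2 a≤b)

encodeSubset : ∀ {q} → (Fin q → Bool) → Fin (2 ^ q)
encodeSubset S = funToFin (Inverse.from Fin.2↔Bool ∘ S)

encodeSubset-injective : ∀ {q} {S S' : Fin q → Bool} → encodeSubset S ≡ encodeSubset S' → S ≗ S'
encodeSubset-injective {S = S} {S'} same c = begin
  S c                                      ≡⟨ Inverse.strictlyInverseˡ Fin.2↔Bool (S c) ⟨
  to (from (S c))                          ≡⟨ cong to (Fin.finToFun-funToFin (from ∘ S) c) ⟨
  to (finToFun (encodeSubset S) c)         ≡⟨ cong (λ w → to (finToFun w c)) same ⟩
  to (finToFun (encodeSubset S') c)        ≡⟨ cong to (Fin.finToFun-funToFin (from ∘ S') c) ⟩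
  to (from (S' c))                         ≡⟨ Inverse.strictlyInverseˡ Fin.2↔Bool (S' c) ⟩
  S' c                                     ∎
  where
  open ≡-Reasoning
  open Inverse Fin.2↔Bool using (to; from)

-- A proper colouring of the shift graph on (m+2)-tuples with q colours
-- yields one of the shift graph on (m+1)-tuples with 2^q colours: colour t
-- by the set of colours of the tuples h ∷ t with h < head t.
shift-colouring-bound : ∀ m {n q} (col : Vector (Fin n) (suc m) → Fin q) →
                        (∀ u v → ShiftArc u v → col u ≢ col v) → n ≤ tower m q
shift-colouring-bound zero {n} {q} col proper with n ≤? q
... | yes n≤q = n≤q
... | no n≰q with Fin.pigeonhole (≰⇒> n≰q) (λ i → col (λ _ → i))
...   | i , j , i<j , same = contradiction same (proper (λ _ → i) (λ _ → j) ((λ ()) , λ { zero → i<j }))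
shift-colouring-bound (suc m) {n} {q} col proper =
  shift-colouring-bound m (encodeSubset ∘ colours-below) proper'
  where
  colours-below : Vector (Fin n) (suc m) → Fin q → Bool
  colours-below t c = does (Fin.any? λ h → h Fin.<? head t ×-dec col (h ∷ t) Fin.≟ c)

  member-below : ∀ t c → colours-below t c ≡ true → ∃[ h ] h Fin.< head t × col (h ∷ t) ≡ c
  member-below t c = dec-true⁻¹ (Fin.any? _)

  proper' : ∀ t t' → ShiftArc t t' → encodeSubset (colours-below t) ≢ encodeSubset (colours-below t')
  proper' t t' (shifted , increasing) same
    with h , h<t₀ , col≡ ← member-below t (col (head t ∷ t'))
           (trans (encodeSubset-injective {S = colours-below t} same _)
                  (dec-true (Fin.any? _) (head t , increasing zero , refl)))
    = proper (h ∷ t) (head t ∷ t')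
        ((λ { zero → refl ; (suc i) → shifted i }) , λ { zero → h<t₀ ; (suc i) → increasing i }) col≡

-- ℤ's +_ is kept local: it clashes with sections of ℕ's _+_.
module _ where
  open import Data.Integer using (+_)

  toℚᵘ-/ : ∀ a d → toℚᵘ (+ a / suc d) ℚᵘ.≃ mkℚᵘ (+ a) d
  toℚᵘ-/ a d = ℚ.toℚᵘ-fromℚᵘ (mkℚᵘ (+ a) d)

  1/n-pos : ∀ n .{{_ : NonZero n}} → 0ℚ <ℚ + 1 / n
  1/n-pos n = ℚ.positive⁻¹ (+ 1 / n) {{ℚ.normalize-pos 1 n}}

  ≤*⇒1/n*≤ : ∀ n .{{_ : NonZero n}} a b → a ≤ n * b → (+ 1 / n) *ℚ (+ a / 1) ≤ℚ + b / 1
  ≤*⇒1/n*≤ (suc n) a b a≤nb = ℚ.toℚᵘ-cancel-≤ (begin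
    toℚᵘ ((+ 1 / suc n) *ℚ (+ a / 1))       ≃⟨ ℚ.toℚᵘ-homo-* (+ 1 / suc n) (+ a / 1) ⟩
    toℚᵘ (+ 1 / suc n) ℚᵘ.* toℚᵘ (+ a / 1) ≃⟨ ℚᵘ.*-cong (toℚᵘ-/ 1 n) (toℚᵘ-/ a 0) ⟩
    mkℚᵘ (+ 1) n ℚᵘ.* mkℚᵘ (+ a) 0         ≤⟨ *≤* (subst₂ ℤ._≤_ (sym a≡) (sym nb≡) (+≤+ a≤nb)) ⟩
    mkℚᵘ (+ b) 0                           ≃⟨ toℚᵘ-/ b 0 ⟨
    toℚᵘ (+ b / 1)                         ∎)
    where
    open ℚᵘ.≤-Reasoning
    a≡ : (+ 1 ℤ.* + a) ℤ.* + 1 ≡ + a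
    a≡ = trans (ℤ.*-identityʳ (+ 1 ℤ.* + a)) (ℤ.*-identityˡ (+ a))
    nb≡ : + b ℤ.* (+ suc n ℤ.* + 1) ≡ + (suc n * b)
    nb≡ = trans (cong (+ b ℤ.*_) (ℤ.*-identityʳ (+ suc n)))
                (trans (ℤ.*-comm (+ b) (+ suc n)) (sym (ℤ.pos-* (suc n) b)))

-- The construction

module Construction (k' n M : ℕ) where

  k ℓ Q : ℕ
  k = 3 + k'
  ℓ = 2 + k'
  Q = M * 2 ^ n

  open Cyclic ℓ using (_⊕_; ⊕-identityʳ; ⊕-assoc; s⊕t≡s⇒t≡0)

  data V : Set where
    tuple  : Vector (Fin n) ℓ → V
    subset : Vector (Fin 2) n → V
    layer  : Fin k → V

  data Arc : V → V → Set where
    shift      : ∀ {u v} → ShiftArc u v → Arc (tuple u) (tuple v)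
    separated  : ∀ {u X} → X (head u) ≡ 0F → X (last u) ≡ 1F → Arc (tuple u) (subset X)
    degenerate : ∀ {u} → head u ≡ last u → Arc (tuple u) (layer 0F)
    toLayer    : ∀ {X} → Arc (subset X) (layer 0F)
    nextLayer  : ∀ {l} → Arc (layer l) (layer (l ⊕ 1))

  Arc? : ∀ x y → Dec (Arc x y)
  Arc? (tuple u)  (tuple v)  = map′ shift (λ { (shift u→v) → u→v }) (ShiftArc? u v)
  Arc? (tuple u)  (subset X) = map′ (uncurry separated) (λ { (separated p q) → p , q })
                                    (X (head u) Fin.≟ 0F ×-dec X (last u) Fin.≟ 1F)
  Arc? (tuple u)  (layer l)  = map′ (λ { (d , refl) → degenerate d }) (λ { (degenerate d) → d , refl })
                                    (head u Fin.≟ last u ×-dec l Fin.≟ 0F)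
  Arc? (subset X) (layer l)  = map′ (λ { refl → toLayer }) (λ { toLayer → refl }) (l Fin.≟ 0F)
  Arc? (layer l)  (layer l') = map′ (λ { refl → nextLayer }) (λ { nextLayer → refl }) (l' Fin.≟ l ⊕ 1)
  Arc? (subset _) (tuple _)  = no λ ()
  Arc? (subset _) (subset _) = no λ ()
  Arc? (layer _)  (tuple _)  = no λ ()
  Arc? (layer _)  (subset _) = no λ ()

  1+k'<k : suc k' < k
  1+k'<k = m<n⇒m<1+n (n<1+n (suc k'))

  layer-injective : ∀ {l l'} → layer l ≡ layer l' → l ≡ l'
  layer-injective refl = refl

  tuple-injective : ∀ {u v} → tuple u ≡ tuple v → u ≡ v
  tuple-injective refl = refl

  Arc⇒≢ : ∀ {x y} → Arc x y → x ≢ y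
  Arc⇒≢ (shift (_ , increasing)) refl = <-irrefl refl (increasing zero)
  Arc⇒≢ (separated _ _) ()
  Arc⇒≢ (degenerate _)  ()
  Arc⇒≢ toLayer         ()
  Arc⇒≢ nextLayer       eq = contradiction (s⊕t≡s⇒t≡0 (s≤s (s≤s z≤n)) (sym (layer-injective eq))) λ ()

  from-layer : ∀ {l y} → Arc (layer l) y → y ≡ layer (l ⊕ 1)
  from-layer nextLayer = refl

  from-subset : ∀ {X y} → Arc (subset X) y → y ≡ layer 0F
  from-subset toLayer = refl

  from-degenerate : ∀ {u y} → Arc (tuple u) y → head u ≡ last u → y ≡ layer 0F
  from-degenerate {u} (shift {v = v} u→v) u₀≡uₗ =
    contradiction (cong toℕ u₀≡uₗ)
                  (<⇒≢ (<-≤-trans (proj₂ u→v zero) (ShiftArc⇒head≤last {u = u} {v} u→v)))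
  from-degenerate (separated {X = X} X[u₀]≡0 X[uₗ]≡1) u₀≡uₗ =
    contradiction (trans (sym X[u₀]≡0) (trans (cong X u₀≡uₗ) X[uₗ]≡1)) λ ()
  from-degenerate (degenerate _) _ = refl

  into-tuple : ∀ {x v} → Arc x (tuple v) → ∃[ u ] x ≡ tuple u × ShiftArc u v
  into-tuple (shift u→v) = _ , refl , u→v

  into-subset : ∀ {x X} → Arc x (subset X) → ∃[ u ] x ≡ tuple u × X (head u) ≡ 0F
  into-subset (separated X[u₀]≡0 _) = _ , refl , X[u₀]≡0

  module _ (W : ShortcutWalk Arc ℓ) where
    open ShortcutWalk W renaming (vertex to q)

    step-at : ∀ j → j < ℓ → ∀ {x y} → q j ≡ x → q (suc j) ≡ y → Arc x y
    step-at j j<ℓ qj≡x qj+1≡y = subst₂ Arc qj≡x qj+1≡y (step j j<ℓ)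

    layers-advance : ∀ {i l} j → i + j ≤ ℓ → q i ≡ layer l → q (i + j) ≡ layer (l ⊕ j)
    layers-advance {i} {l} zero _ qi≡ =
      trans (cong q (+-identityʳ i)) (trans qi≡ (cong layer (sym (⊕-identityʳ l))))
    layers-advance {i} {l} (suc j) i+1+j≤ℓ qi≡ = begin
      q (i + suc j)       ≡⟨ cong q (+-suc i j) ⟩
      q (suc (i + j))     ≡⟨ from-layer (step-at (i + j) i+j<ℓ (layers-advance j (<⇒≤ i+j<ℓ) qi≡) refl) ⟩
      layer (l ⊕ j ⊕ 1)   ≡⟨ cong layer (trans (⊕-assoc l j 1) (cong (l ⊕_) (+-comm j 1))) ⟩
      layer (l ⊕ suc j)   ∎
      where
      open ≡-Reasoning
      i+j<ℓ : i + j < ℓ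
      i+j<ℓ = subst (_≤ ℓ) (+-suc i j) i+1+j≤ℓ

    stuck-in-layer-0 : q 1 ≡ layer 0F → q ℓ ≡ layer 0F → ⊥
    stuck-in-layer-0 q₁≡ qℓ≡ = contradiction
      (s⊕t≡s⇒t≡0 1+k'<k (layer-injective (trans (sym (layers-advance (suc k') ≤-refl q₁≡)) qℓ≡))) λ ()

    last-moves-left : ∀ {u} → q 0 ≡ tuple u → ∀ j → j < ℓ → ∀ {t} → q j ≡ tuple t →
                      ∀ i → toℕ i + j ≡ suc k' → t i ≡ last u
    last-moves-left {u} q₀≡ zero _ {t} qj≡ i i≡ = begin
      t i                      ≡⟨ cong (λ w → w i) (tuple-injective (trans (sym qj≡) q₀≡)) ⟩
      u i                      ≡⟨ cong u (Fin.toℕ-injective (trans (trans (sym (+-identityʳ (toℕ i))) i≡)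
                                                                  (sym (Fin.toℕ-fromℕ (suc k'))))) ⟩
      u (Fin.fromℕ (suc k'))   ∎
      where open ≡-Reasoning
    last-moves-left {u} q₀≡ (suc j) 1+j<ℓ {t} qj≡ i i+1+j≡
      with s , qs≡ , s→t ← into-tuple (step-at j (<-trans (n<1+n j) 1+j<ℓ) refl qj≡) = begin
      t i                  ≡⟨ cong t (inject₁-lower₁ i i≢1+k') ⟨
      t (Fin.inject₁ i')   ≡⟨ proj₁ s→t i' ⟩
      s (suc i')           ≡⟨ last-moves-left q₀≡ j (<-trans (n<1+n j) 1+j<ℓ) qs≡ (suc i') 1+i'+j≡ ⟩
      last u               ∎
      where
      open ≡-Reasoning
      i≢1+k' : suc k' ≢ toℕ i
      i≢1+k' eq = contradiction (trans (cong (_+ suc j) eq) i+1+j≡) (m+1+n≢m (suc k'))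
      i' : Fin (suc k')
      i' = Fin.lower₁ i i≢1+k'
      1+i'+j≡ : suc (toℕ i') + j ≡ suc k'
      1+i'+j≡ = trans (cong (λ x → suc x + j) (Fin.toℕ-lower₁ i i≢1+k'))
                      (trans (sym (+-suc (toℕ i) j)) i+1+j≡)

    shortcut-impossible : ∀ {x y} → q 0 ≡ x → q ℓ ≡ y → Arc x y → ⊥
    shortcut-impossible q₀≡ qℓ≡ (shift {u} {v} u→v)
      with s , qs≡ , s→v ← into-tuple (step-at (suc k') ≤-refl refl qℓ≡) =
      <⇒≢ (<-≤-trans (proj₂ s→v zero) (ShiftArc⇒head≤last {u = u} {v} u→v))
          (cong toℕ (last-moves-left q₀≡ (suc k') ≤-refl qs≡ zero refl))
    shortcut-impossible q₀≡ qℓ≡ (separated {u} {X} X[u₀]≡0 X[uₗ]≡1)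
      with s , qs≡ , X[s₀]≡0 ← into-subset (step-at (suc k') ≤-refl refl qℓ≡) =
      contradiction (trans (sym X[s₀]≡0)
                           (trans (cong X (last-moves-left q₀≡ (suc k') ≤-refl qs≡ zero refl)) X[uₗ]≡1))
                    λ ()
    shortcut-impossible q₀≡ qℓ≡ (degenerate u₀≡uₗ) =
      stuck-in-layer-0 (from-degenerate (step-at 0 (s≤s z≤n) q₀≡ refl) u₀≡uₗ) qℓ≡
    shortcut-impossible q₀≡ qℓ≡ toLayer =
      stuck-in-layer-0 (from-subset (step-at 0 (s≤s z≤n) q₀≡ refl)) qℓ≡
    shortcut-impossible q₀≡ qℓ≡ (nextLayer {l}) = contradiction
      (s⊕t≡s⇒t≡0 1+k'<k (trans (⊕-assoc l 1 (suc k'))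
        (layer-injective (trans (sym (layers-advance ℓ ≤-refl q₀≡)) qℓ≡)))) λ ()

  no-shortcut-walk : ¬ ShortcutWalk Arc ℓ
  no-shortcut-walk W = shortcut-impossible W refl refl (ShortcutWalk.shortcut W)

  size : ℕ
  size = n ^ ℓ + (Q + k * Q)

  -- the n ^ ℓ tuples, then M copies of each of the 2 ^ n subsets, then Q
  -- copies of each of the k layers
  decode : Fin size → V
  decode w = [ tuple ∘ finToFun
             , [ subset ∘ finToFun ∘ remainder {M} (2 ^ n) , layer ∘ quotient {k} Q ]′ ∘ splitAt Q
             ]′ (splitAt (n ^ ℓ) w)

  decode-tuple : ∀ w → decode (w ↑ˡ (Q + k * Q)) ≡ tuple (finToFun w)
  decode-tuple w rewrite splitAt-↑ˡ (n ^ ℓ) w (Q + k * Q) = refl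

  decode-subset : ∀ w → decode (n ^ ℓ ↑ʳ (w ↑ˡ k * Q)) ≡ subset (finToFun (remainder {M} (2 ^ n) w))
  decode-subset w rewrite splitAt-↑ʳ (n ^ ℓ) (Q + k * Q) (w ↑ˡ k * Q) | splitAt-↑ˡ Q w (k * Q) = refl

  decode-layer : ∀ w → decode (n ^ ℓ ↑ʳ (Q ↑ʳ w)) ≡ layer (quotient {k} Q w)
  decode-layer w rewrite splitAt-↑ʳ (n ^ ℓ) (Q + k * Q) (Q ↑ʳ w) | splitAt-↑ʳ Q (k * Q) w = refl

  D : Digraph
  D = record
    { N        = size
    ; arc      = λ a b → does (Arc? (decode a) (decode b))
    ; loopless = λ a → dec-false (Arc? (decode a) (decode a)) (λ a→a → Arc⇒≢ a→a refl)
    }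

  outdegV : V → ℕ
  outdegV x = countTrue size (λ b → does (Arc? x (decode b)))

  subsets≤outdegV : ∀ x →
    countTrue Q (λ w → does (Arc? x (subset (finToFun (remainder {M} (2 ^ n) w))))) ≤ outdegV x
  subsets≤outdegV x = begin
    countTrue Q (λ w → does (Arc? x (subset (finToFun (remainder {M} (2 ^ n) w)))))
      ≡⟨ countTrue-cong Q (λ w → cong (does ∘ Arc? x) (decode-subset w)) ⟨
    countTrue Q (λ w → out (n ^ ℓ ↑ʳ (w ↑ˡ k * Q)))
      ≤⟨ countTrue-↑ˡ-≤ Q (k * Q) (λ w → out (n ^ ℓ ↑ʳ w)) ⟩
    countTrue (Q + k * Q) (λ w → out (n ^ ℓ ↑ʳ w))
      ≤⟨ countTrue-↑ʳ-≤ (n ^ ℓ) (Q + k * Q) out ⟩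
    outdegV x ∎
    where
    open ≤-Reasoning
    out : Fin size → Bool
    out b = does (Arc? x (decode b))

  layers≤outdegV : ∀ x → countTrue (k * Q) (λ w → does (Arc? x (layer (quotient {k} Q w)))) ≤ outdegV x
  layers≤outdegV x = begin
    countTrue (k * Q) (λ w → does (Arc? x (layer (quotient {k} Q w))))
      ≡⟨ countTrue-cong (k * Q) (λ w → cong (does ∘ Arc? x) (decode-layer w)) ⟨
    countTrue (k * Q) (λ w → out (n ^ ℓ ↑ʳ (Q ↑ʳ w)))
      ≤⟨ countTrue-↑ʳ-≤ Q (k * Q) (λ w → out (n ^ ℓ ↑ʳ w)) ⟩
    countTrue (Q + k * Q) (λ w → out (n ^ ℓ ↑ʳ w))
      ≤⟨ countTrue-↑ʳ-≤ (n ^ ℓ) (Q + k * Q) out ⟩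
    outdegV x ∎
    where
    open ≤-Reasoning
    out : Fin size → Bool
    out b = does (Arc? x (decode b))

  arc-to-layer⇒Q≤outdegV : ∀ {x l} → Arc x (layer l) → Q ≤ outdegV x
  arc-to-layer⇒Q≤outdegV {x} {l} x→l = begin
    Q                                                                  ≡⟨ countTrue-true Q ⟨
    countTrue Q (λ _ → true)                                           ≡⟨ countTrue-quotient k Q l _ ⟨
    countTrue (k * Q) (λ w → does (quotient {k} Q w Fin.≟ l) ∧ true)
      ≤⟨ countTrue-mono (k * Q) (λ w in-l → dec-true (Arc? x _)
           (subst (Arc x ∘ layer) (sym (dec-true⁻¹ (_ Fin.≟ l) (∧-conicalˡ _ _ in-l))) x→l)) ⟩
    countTrue (k * Q) (λ w → does (Arc? x (layer (quotient {k} Q w)))) ≤⟨ layers≤outdegV x ⟩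
    outdegV x                                                          ∎
    where open ≤-Reasoning

  -- a quarter of all subsets X has head u ∉ X ∋ last u
  nondegenerate⇒Q≤4*outdegV : ∀ {u} → head u ≢ last u → Q ≤ 4 * outdegV (tuple u)
  nondegenerate⇒Q≤4*outdegV {u} u₀≢uₗ = begin
    M * 2 ^ n                                  ≡⟨ cong (M *_) (countTrue-finToFun-≡≡ 2 n u₀≢uₗ 0F 1F) ⟨
    M * (4 * count)                            ≡⟨ *-assoc M 4 count ⟨
    M * 4 * count                              ≡⟨ cong (_* count) (*-comm M 4) ⟩
    4 * M * count                              ≡⟨ *-assoc 4 M count ⟩
    4 * (M * count)                            ≡⟨ cong (4 *_) (countTrue-remainder M (2 ^ n) separating) ⟨
    4 * countTrue Q (separating ∘ remainder {M} (2 ^ n))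
      ≤⟨ *-monoʳ-≤ 4 (countTrue-mono Q separating⇒arc) ⟩
    4 * countTrue Q (λ w → does (Arc? (tuple u) (subset (X w))))
      ≤⟨ *-monoʳ-≤ 4 (subsets≤outdegV (tuple u)) ⟩
    4 * outdegV (tuple u) ∎
    where
    open ≤-Reasoning
    separating : Fin (2 ^ n) → Bool
    separating w = does (finToFun w (head u) Fin.≟ 0F) ∧ does (finToFun w (last u) Fin.≟ 1F)
    count : ℕ
    count = countTrue (2 ^ n) separating
    X : Fin Q → Vector (Fin 2) n
    X w = finToFun (remainder {M} (2 ^ n) w)
    separating⇒arc : ∀ w → separating (remainder {M} (2 ^ n) w) ≡ true →
                     does (Arc? (tuple u) (subset (X w))) ≡ true
    separating⇒arc w sep = dec-true (Arc? (tuple u) (subset (X w))) (separated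
      (dec-true⁻¹ (X w (head u) Fin.≟ 0F) (∧-conicalˡ _ _ sep))
      (dec-true⁻¹ (X w (last u) Fin.≟ 1F) (∧-conicalʳ _ _ sep)))

  Q≤4*outdegV : ∀ x → Q ≤ 4 * outdegV x
  Q≤4*outdegV (tuple u) with head u Fin.≟ last u
  ... | yes u₀≡uₗ = ≤-trans (arc-to-layer⇒Q≤outdegV (degenerate u₀≡uₗ)) (m≤m+n _ _)
  ... | no u₀≢uₗ = nondegenerate⇒Q≤4*outdegV u₀≢uₗ
  Q≤4*outdegV (subset X) = ≤-trans (arc-to-layer⇒Q≤outdegV toLayer) (m≤m+n _ _)
  Q≤4*outdegV (layer l)  = ≤-trans (arc-to-layer⇒Q≤outdegV nextLayer) (m≤m+n _ _)

  M≤Q : M ≤ Q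
  M≤Q = ≤-trans (≤-reflexive (sym (*-identityʳ M))) (*-monoʳ-≤ M (m^n>0 2 n))

  size≤outdeg : n ^ ℓ ≤ M → ∀ v → size ≤ (2 + k) * 4 * outdeg D v
  size≤outdeg n^ℓ≤M v = begin
    n ^ ℓ + (Q + k * Q)                   ≤⟨ +-monoˡ-≤ (Q + k * Q) (≤-trans n^ℓ≤M M≤Q) ⟩
    (2 + k) * Q                           ≤⟨ *-monoʳ-≤ (2 + k) (Q≤4*outdegV (decode v)) ⟩
    (2 + k) * (4 * outdegV (decode v))    ≡⟨ *-assoc (2 + k) 4 (outdeg D v) ⟨
    (2 + k) * 4 * outdeg D v              ∎
    where open ≤-Reasoning

  M≤size : M ≤ size
  M≤size = ≤-trans M≤Q (≤-trans (m≤m+n Q (k * Q)) (m≤n+m _ (n ^ ℓ)))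

  χ≥ : ∀ c → tower (suc k') c < n → ChromaticAtLeast D c
  χ≥ c tower<n m col proper with c ≤? m
  ... | yes c≤m = c≤m
  ... | no c≰m = contradiction (≤-trans n≤tower (tower-monoʳ-≤ (suc k') (<⇒≤ (≰⇒> c≰m)))) (<⇒≱ tower<n)
    where
    encode : Vector (Fin n) ℓ → Fin size
    encode t = funToFin t ↑ˡ (Q + k * Q)
    shift-arc : ∀ u v → ShiftArc u v → arc D (encode u) (encode v) ≡ true
    shift-arc u v u→v = dec-true (Arc? _ _)
      (subst₂ Arc (sym (decode-tuple (funToFin u))) (sym (decode-tuple (funToFin v)))
        (shift (ShiftArc-resp-≗ (sym ∘ Fin.finToFun-funToFin u) (sym ∘ Fin.finToFun-funToFin v) u→v)))
    n≤tower : n ≤ tower (suc k') m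
    n≤tower = shift-colouring-bound (suc k') (col ∘ encode) (λ u v u→v → proper _ _ (shift-arc u v u→v))

  D-avoids : ∀ o → TwoBlocksOneOfLengthOne k o → ¬ ContainsOrientedCycle k D o
  D-avoids o blocks (f , _ , arcs) = no-shortcut-walk
    (ShortcutWalk-map (decode ∘ f) (λ {a} {b} a→b → dec-true⁻¹ (Arc? _ _) (arcs a b a→b))
      (Cyclic.twoBlocks⇒shortcutWalk ℓ o blocks))

theorem3p3 : (k : ℕ) → .{{_ : NonZero k}} → 3 ≤ k →
    Σ ℚ λ ε → 0ℚ <ℚ ε ×
      ((n c : ℕ) (o : Orientation k) → TwoBlocksOneOfLengthOne k o →
        Σ Digraph λ D →
          n ≤ N D × ChromaticAtLeast D c × MinOutdegAtLeast ε D
          × ¬ ContainsOrientedCycle k D o)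
theorem3p3 (suc (suc (suc k'))) (s≤s (s≤s (s≤s z≤n))) = _ , 1/n-pos ((5 + k') * 4) , λ n₀ c o blocks →
  let n : ℕ
      n = suc (tower (suc k') c)
      open Construction k' n (n ^ (2 + k') + n₀)
  in D
   , ≤-trans (m≤n+m n₀ _) M≤size
   , χ≥ c ≤-refl
   , (λ v → ≤*⇒1/n*≤ ((5 + k') * 4) size (outdeg D v) (size≤outdeg (m≤m+n _ n₀) v))
   , D-avoids o blocks
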